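{- Every tournament on the ordered vertex set $\{1,2,3\}$ (i.e. each of the $2^{3}=8$ digraphs on $\{1,2,3\}$ having, for each pair of distinct vertices $x,y$, exactly one of the edges $x\to y$, $y\to x$) is representable as an RNA conflict digraph.
   Context: For pairs $\{a,b\},\{c,d\}$ of positions: they touch if $|\{a,b\}\cap\{c,d\}|=1$; they cross if $\min(a,b)<\min(c,d)<\max(a,b)<\max(c,d)$ or $\min(c,d)<\min(a,b)<\max(c,d)<\max(a,b)$. A secondary structure for an RNA sequence $a_1,\ldots,a_m$ is a set of pairs $(i,j)$, $i<j$, with $a_ia_j\in\{GC,CG,AU,UA,GU,UG\}$, no position in two pairs, no two crossing pairs, and $j-i>3$. Triples $(x,y,z)$ are ordered by $(x,y,z)\prec(x',y',z')$ iff $y<y'$, or $y=y'$ and $x<x'$, or $y=y'$, $x=x'$ and $z<z'$. For a triple $v=(x,y,z)$ write $v.t=\{x,y\}$, $v.s=\{y,z\}$. A digraph $G=(V,E)$ with $V=\{1,\ldots,n\}$ is representable (as an RNA conflict digraph) if there exist secondary structures $s,t$ of some RNA sequence and a map $\Phi$ from $V$ to triples such that: (1) $u<v$ iff $\Phi(u)\prec\Phi(v)$; (2) each $\Phi(v)=(x,y,z)$ has $x,y,z$ distinct with $\{x,y\}\in t$ and $\{y,z\}\in s$; (3) for distinct $u,v\in V$, $(u,v)\in E$ iff $\Phi(u).s$ touches or crosses $\Phi(v).t$. -}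

module Defs where

open import Data.Nat using (ℕ; zero; suc; _<_; _≤_; _+_; _⊔_; _⊓_)
open import Data.Fin using (Fin)
open import Data.Bool using (Bool; true; false)
open import Data.List using (List; length)
open import Data.List.Membership.Propositional using (_∈_)
open import Data.Product using (_×_; _,_; Σ; ∃-syntax)
open import Data.Sum using (_⊎_)
open import Relation.Binary.PropositionalEquality using (_≡_; _≢_)
open import Relation.Nullary using (¬_)
open import Function.Bundles using (_⇔_)

data Base : Set where
  A C G U : Base

data CanPair : Base → Base → Set where
  GC : CanPair G C
  CG : CanPair C G
  AU : CanPair A U
  UA : CanPair U A
  GU : CanPair G U
  UG : CanPair U G

RNA : Set
RNA = List Base

-- BaseAt w i b : the base at (1-based) position i of w is b
data BaseAt : RNA → ℕ → Base → Set where
  here  : ∀ {b w} → BaseAt (b List.∷ w) 1 b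
  there : ∀ {b c w i} → BaseAt w i c → BaseAt (b List.∷ w) (suc i) c

-- Pairs of positions (a pair {a,b} is represented by the ordered pair (a , b))

Pair : Set
Pair = ℕ × ℕ

lo hi : Pair → ℕ
lo (a , b) = a ⊓ b
hi (a , b) = a ⊔ b

_∈ₚ_ : ℕ → Pair → Set
x ∈ₚ (a , b) = (x ≡ a) ⊎ (x ≡ b)

-- |{a,b} ∩ {c,d}| = 1  (for pairs of distinct positions)
Touch : Pair → Pair → Set
Touch p q = (Σ ℕ λ x → x ∈ₚ p × x ∈ₚ q) × ¬ (∀ x → x ∈ₚ p → x ∈ₚ q)

Cross : Pair → Pair → Set
Cross p q = (lo p < lo q × lo q < hi p × hi p < hi q)
          ⊎ (lo q < lo p × lo p < hi q × hi q < hi p)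

-- Secondary structures: finite sets of pairs (i , j), i < j, given as lists

record IsSecondaryStructure (w : RNA) (S : List Pair) : Set where
  field
    valid    : ∀ {i j} → (i , j) ∈ S →
               1 ≤ i × i < j × j ≤ length w × i + 3 < j ×
               Σ Base λ b → Σ Base λ c → BaseAt w i b × BaseAt w j c × CanPair b c
    disjoint : ∀ {p q} → p ∈ S → q ∈ S → p ≢ q → ∀ x → x ∈ₚ p → ¬ (x ∈ₚ q)
    noCross  : ∀ {p q} → p ∈ S → q ∈ S → ¬ Cross p q

_∈ᵤ_ : Pair → List Pair → Set
(x , y) ∈ᵤ S = ((x , y) ∈ S) ⊎ ((y , x) ∈ S)

Triple : Set
Triple = ℕ × ℕ × ℕ

_≺_ : Triple → Triple → Set
(x , y , z) ≺ (x' , y' , z') =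
  (y < y') ⊎ (y ≡ y' × x < x') ⊎ (y ≡ y' × x ≡ x' × z < z')

tPart sPart : Triple → Pair
tPart (x , y , z) = (x , y)
sPart (x , y , z) = (y , z)

Distinct3 : Triple → Set
Distinct3 (x , y , z) = x ≢ y × y ≢ z × x ≢ z

-- Digraphs on {1,…,n} (vertex i+1 is represented by i : Fin n),
-- given by their edge indicator.

Digraph : ℕ → Set
Digraph n = Fin n → Fin n → Bool

Edge : ∀ {n} → Digraph n → Fin n → Fin n → Set
Edge E u v = E u v ≡ true

record IsTournament {n} (E : Digraph n) : Set where
  field
    loopless : ∀ x → ¬ Edge E x x
    oneOf    : ∀ x y → x ≢ y → Edge E x y ⊎ Edge E y x
    notBoth  : ∀ x y → Edge E x y → ¬ Edge E y x

Representable : ∀ {n} → Digraph n → Set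
Representable {n} E =
  Σ RNA λ w → Σ (List Pair) λ s → Σ (List Pair) λ t → Σ (Fin n → Triple) λ Φ →
    IsSecondaryStructure w s × IsSecondaryStructure w t ×
    (∀ u v → (u Data.Fin.< v) ⇔ (Φ u ≺ Φ v)) ×
    (∀ v → Distinct3 (Φ v) × tPart (Φ v) ∈ᵤ t × sPart (Φ v) ∈ᵤ s) ×
    (∀ u v → u ≢ v →
       Edge E u v ⇔ (Touch (sPart (Φ u)) (tPart (Φ v)) ⊎ Cross (sPart (Φ u)) (tPart (Φ v))))

module Submission where

-- A tournament on three vertices is determined by the orientations of its
-- three edges 1–2, 1–3 and 2–3, and representability only depends on the
-- edges between distinct vertices; so every tournament on {1,2,3} agrees
-- with one of the eight normal forms  tournament₃ b₁₂ b₁₃ b₂₃.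
--
-- For each normal form we exhibit an explicit representation: an RNA
-- sequence of length 14, two secondary structures s and t with three pairs
-- each, and a map Φ from vertices to triples.  That the data is a
-- representation is a finite check.

open import Defs
open import Data.Nat as ℕ using (ℕ; zero; suc; _+_; _≤?_; _<?_)
open import Data.Fin as Fin using (Fin) renaming (zero to 𝟘; suc to fsuc)
import Data.Fin.Properties as Fin
open import Data.Bool using (Bool; true; false; not)
import Data.Bool.Properties as Bool
open import Data.List using (List; []; _∷_; length)
import Data.List.Relation.Unary.Any as Any
open import Data.List.Relation.Unary.All as All using (All)
open import Data.Vec using (Vec; lookup) renaming (_∷_ to _∷ᵥ_; [] to []ᵥ)
open import Data.Product using (_×_; _,_; Σ; ∃)
open import Data.Product.Properties using (≡-dec)
open import Data.Sum using (_⊎_; inj₁; inj₂)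
open import Data.Empty using (⊥-elim)
open import Relation.Binary.PropositionalEquality
  using (_≡_; _≢_; refl; sym; trans; subst₂)
open import Relation.Nullary using (¬_; Dec; yes; no; contradiction)
open import Relation.Nullary.Decidable
  using (True; toWitness; map; map′; _×-dec_; _⊎-dec_; _→-dec_; ¬?)
open import Function.Bundles using (_⇔_; mk⇔; Equivalence)

pattern 𝟙 = fsuc 𝟘
pattern 𝟚 = fsuc 𝟙

reverse-edge : ∀ {n} {E : Digraph n} → IsTournament E →
               ∀ x y → x ≢ y → E y x ≡ not (E x y)
reverse-edge {E = E} T x y x≢y with E x y in xy | E y x in yx
... | true  | true  = ⊥-elim (IsTournament.notBoth T x y xy yx)
... | true  | false = refl
... | false | true  = refl
... | false | false with IsTournament.oneOf T x y x≢y
...   | inj₁ xy′ = contradiction (trans (sym xy′) xy) λ ()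
...   | inj₂ yx′ = contradiction (trans (sym yx′) yx) λ ()

tournament₃ : Bool → Bool → Bool → Digraph 3
tournament₃ b₁₂ b₁₃ b₂₃ = λ u v → lookup (lookup table u) v
  where
  table : Vec (Vec Bool 3) 3
  table = (false   ∷ᵥ b₁₂     ∷ᵥ b₁₃     ∷ᵥ []ᵥ)
       ∷ᵥ (not b₁₂ ∷ᵥ false   ∷ᵥ b₂₃     ∷ᵥ []ᵥ)
       ∷ᵥ (not b₁₃ ∷ᵥ not b₂₃ ∷ᵥ false   ∷ᵥ []ᵥ)
       ∷ᵥ []ᵥ

tournament₃-normal-form : ∀ {E : Digraph 3} → IsTournament E →
  ∀ u v → u ≢ v → tournament₃ (E 𝟘 𝟙) (E 𝟘 𝟚) (E 𝟙 𝟚) u v ≡ E u v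
tournament₃-normal-form T 𝟘 𝟘 u≢v = ⊥-elim (u≢v refl)
tournament₃-normal-form T 𝟘 𝟙 _ = refl
tournament₃-normal-form T 𝟘 𝟚 _ = refl
tournament₃-normal-form T 𝟙 𝟘 _ = sym (reverse-edge T 𝟘 𝟙 λ ())
tournament₃-normal-form T 𝟙 𝟙 u≢v = ⊥-elim (u≢v refl)
tournament₃-normal-form T 𝟙 𝟚 _ = refl
tournament₃-normal-form T 𝟚 𝟘 _ =
  sym (reverse-edge T 𝟘 𝟚 λ ())
tournament₃-normal-form T 𝟚 𝟙 _ =
  sym (reverse-edge T 𝟙 𝟚 λ ())
tournament₃-normal-form T 𝟚 𝟚 u≢v = ⊥-elim (u≢v refl)

representable-resp : ∀ {n} {E F : Digraph n} →
  (∀ u v → u ≢ v → E u v ≡ F u v) → Representable E → Representable F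
representable-resp E≡F (w , s , t , Φ , ss , st , ord , trip , conflict) =
  w , s , t , Φ , ss , st , ord , trip , λ u v u≢v →
    let open Equivalence (conflict u v u≢v) in
    mk⇔ (λ e → to (trans (E≡F u v u≢v) e)) (λ c → trans (sym (E≡F u v u≢v)) (from c))

_⇔?_ : ∀ {P Q : Set} → Dec P → Dec Q → Dec (P ⇔ Q)
P? ⇔? Q? = map′ (λ (f , g) → mk⇔ f g) (λ P⇔Q → Equivalence.to P⇔Q , Equivalence.from P⇔Q)
                ((P? →-dec Q?) ×-dec (Q? →-dec P?))

∀-pair : ∀ {P : ℕ → Set} a b → (P a × P b) ⇔ (∀ x → x ∈ₚ (a , b) → P x)
∀-pair a b = mk⇔ (λ { (Pa , Pb) x (inj₁ refl) → Pa ; (Pa , Pb) x (inj₂ refl) → Pb })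
                 (λ f → f a (inj₁ refl) , f b (inj₂ refl))

∃-pair : ∀ {P : ℕ → Set} a b → (P a ⊎ P b) ⇔ (Σ ℕ λ x → x ∈ₚ (a , b) × P x)
∃-pair a b = mk⇔ (λ { (inj₁ Pa) → a , inj₁ refl , Pa ; (inj₂ Pb) → b , inj₂ refl , Pb })
                 (λ { (x , inj₁ refl , Px) → inj₁ Px ; (x , inj₂ refl , Px) → inj₂ Px })

_∈ₚ?_ : ∀ x p → Dec (x ∈ₚ p)
x ∈ₚ? (a , b) = (x ℕ.≟ a) ⊎-dec (x ℕ.≟ b)

touch? : ∀ p q → Dec (Touch p q)
touch? (a , b) q = map (∃-pair a b) ((a ∈ₚ? q) ⊎-dec (b ∈ₚ? q))
            ×-dec ¬? (map (∀-pair a b) ((a ∈ₚ? q) ×-dec (b ∈ₚ? q)))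

cross? : ∀ p q → Dec (Cross p q)
cross? p q = (lo p <? lo q ×-dec lo q <? hi p ×-dec hi p <? hi q)
      ⊎-dec (lo q <? lo p ×-dec lo p <? hi q ×-dec hi q <? hi p)

Apart : Pair → Pair → Set
Apart p q = ∀ x → x ∈ₚ p → ¬ (x ∈ₚ q)

apart? : ∀ p q → Dec (Apart p q)
apart? (a , b) q = map (∀-pair a b) (¬? (a ∈ₚ? q) ×-dec ¬? (b ∈ₚ? q))

-- The base at a given position, when the position lies inside the sequence;
-- it is unique, which makes the pairing condition decidable.
baseAt? : ∀ w i → Dec (∃ λ b → BaseAt w i b)
baseAt? [] i = no λ { (_ , ()) }
baseAt? (b ∷ w) zero = no λ { (_ , ()) }
baseAt? (b ∷ w) (suc zero) = yes (b , here)
baseAt? (b ∷ w) (suc (suc i)) =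
  map′ (λ (c , at) → c , there at) (λ { (c , there at) → c , at }) (baseAt? w (suc i))

baseAt-unique : ∀ {w i b c} → BaseAt w i b → BaseAt w i c → b ≡ c
baseAt-unique here here = refl
baseAt-unique (there at) (there at′) = baseAt-unique at at′

canPair? : ∀ b c → Dec (CanPair b c)
canPair? A A = no λ ()
canPair? A C = no λ ()
canPair? A G = no λ ()
canPair? A U = yes AU
canPair? C A = no λ ()
canPair? C C = no λ ()
canPair? C G = yes CG
canPair? C U = no λ ()
canPair? G A = no λ ()
canPair? G C = yes GC
canPair? G G = no λ ()
canPair? G U = yes GU
canPair? U A = yes UA
canPair? U C = no λ ()
canPair? U G = yes UG
canPair? U U = no λ ()

Pairable : RNA → ℕ → ℕ → Set
Pairable w i j = Σ Base λ b → Σ Base λ c → BaseAt w i b × BaseAt w j c × CanPair b c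

pairable? : ∀ w i j → Dec (Pairable w i j)
pairable? w i j with baseAt? w i | baseAt? w j
... | no ¬at | _ = no λ (b , _ , at , _) → ¬at (b , at)
... | yes _ | no ¬at = no λ (_ , c , _ , at , _) → ¬at (c , at)
... | yes (b , atᵢ) | yes (c , atⱼ) =
  map′ (λ bc → b , c , atᵢ , atⱼ , bc)
       (λ (_ , _ , atᵢ′ , atⱼ′ , bc) →
          subst₂ CanPair (baseAt-unique atᵢ′ atᵢ) (baseAt-unique atⱼ′ atⱼ) bc)
       (canPair? b c)

ValidPair : RNA → Pair → Set
ValidPair w (i , j) =
  1 ℕ.≤ i × i ℕ.< j × j ℕ.≤ length w × i + 3 ℕ.< j × Pairable w i j

validPair? : ∀ w p → Dec (ValidPair w p)
validPair? w (i , j) = 1 ≤? i ×-dec i <? j ×-dec j ≤? length w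
                ×-dec i + 3 <? j ×-dec pairable? w i j

SecondaryStructureCheck : RNA → List Pair → Set
SecondaryStructureCheck w S =
  All (ValidPair w) S ×
  All (λ p → All (λ q → p ≡ q ⊎ Apart p q) S) S ×
  All (λ p → All (λ q → ¬ Cross p q) S) S

secondaryStructureCheck? : ∀ w S → Dec (SecondaryStructureCheck w S)
secondaryStructureCheck? w S =
  All.all? (validPair? w) S
  ×-dec All.all? (λ p → All.all? (λ q → ≡-dec ℕ._≟_ ℕ._≟_ p q ⊎-dec apart? p q) S) S
  ×-dec All.all? (λ p → All.all? (λ q → ¬? (cross? p q)) S) S

secondaryStructureCheck-sound : ∀ {w S} →
  SecondaryStructureCheck w S → IsSecondaryStructure w S
secondaryStructureCheck-sound (valid , apart , noCross) = record
  { valid    = All.lookup valid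
  ; disjoint = λ p∈S q∈S p≢q → apart-or-equal (All.lookup (All.lookup apart p∈S) q∈S) p≢q
  ; noCross  = λ p∈S q∈S → All.lookup (All.lookup noCross p∈S) q∈S
  }
  where
  apart-or-equal : ∀ {p q} → p ≡ q ⊎ Apart p q → p ≢ q → Apart p q
  apart-or-equal (inj₁ p≡q) p≢q = ⊥-elim (p≢q p≡q)
  apart-or-equal (inj₂ p#q) _ = p#q

_≺?_ : ∀ u v → Dec (u ≺ v)
(x , y , z) ≺? (x′ , y′ , z′) =
  y <? y′ ⊎-dec (y ℕ.≟ y′ ×-dec x <? x′) ⊎-dec (y ℕ.≟ y′ ×-dec x ℕ.≟ x′ ×-dec z <? z′)

distinct3? : ∀ v → Dec (Distinct3 v)
distinct3? (x , y , z) = ¬? (x ℕ.≟ y) ×-dec ¬? (y ℕ.≟ z) ×-dec ¬? (x ℕ.≟ z)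

Conflict : Triple → Triple → Set
Conflict a b = Touch (sPart a) (tPart b) ⊎ Cross (sPart a) (tPart b)

conflict? : ∀ a b → Dec (Conflict a b)
conflict? a b = touch? (sPart a) (tPart b) ⊎-dec cross? (sPart a) (tPart b)

_∈ᵤ?_ : ∀ p S → Dec (p ∈ᵤ S)
(x , y) ∈ᵤ? S = Any.any? (≡-dec ℕ._≟_ ℕ._≟_ (x , y)) S
         ⊎-dec Any.any? (≡-dec ℕ._≟_ ℕ._≟_ (y , x)) S

record Witness (n : ℕ) : Set where
  constructor witness
  field
    rna : RNA
    s t : List Pair
    Φ   : Fin n → Triple

Certificate : ∀ {n} → Digraph n → Witness n → Set
Certificate E (witness w s t Φ) =
  SecondaryStructureCheck w s × SecondaryStructureCheck w t ×
  (∀ u v → (u Fin.< v) ⇔ (Φ u ≺ Φ v)) ×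
  (∀ v → Distinct3 (Φ v) × tPart (Φ v) ∈ᵤ t × sPart (Φ v) ∈ᵤ s) ×
  (∀ u v → u ≢ v → Edge E u v ⇔ Conflict (Φ u) (Φ v))

certificate? : ∀ {n} (E : Digraph n) W → Dec (Certificate E W)
certificate? E (witness w s t Φ) =
  secondaryStructureCheck? w s ×-dec secondaryStructureCheck? w t
  ×-dec Fin.all? (λ u → Fin.all? λ v → (u Fin.<? v) ⇔? (Φ u ≺? Φ v))
  ×-dec Fin.all? (λ v → distinct3? (Φ v) ×-dec tPart (Φ v) ∈ᵤ? t ×-dec sPart (Φ v) ∈ᵤ? s)
  ×-dec Fin.all? (λ u → Fin.all? λ v →
          ¬? (u Fin.≟ v) →-dec ((E u v Bool.≟ true) ⇔? conflict? (Φ u) (Φ v)))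

certificate-sound : ∀ {n} {E : Digraph n} W → Certificate E W → Representable E
certificate-sound (witness w s t Φ) (ss , st , ord , trip , conflict) =
  w , s , t , Φ , secondaryStructureCheck-sound ss , secondaryStructureCheck-sound st ,
  ord , trip , conflict

triples : Triple → Triple → Triple → Fin 3 → Triple
triples a b c = lookup (a ∷ᵥ b ∷ᵥ c ∷ᵥ []ᵥ)

representation₃ : Bool → Bool → Bool → Witness 3
representation₃ false false false =
  witness (G ∷ G ∷ G ∷ A ∷ C ∷ A ∷ C ∷ C ∷ A ∷ A ∷ A ∷ G ∷ G ∷ C ∷ [])
          ((1 , 14) ∷ (2 , 8) ∷ (3 , 7) ∷ []) ((1 , 5) ∷ (7 , 13) ∷ (8 , 12) ∷ [])
          (triples (5 , 1 , 14) (13 , 7 , 3) (12 , 8 , 2))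
representation₃ false false true =
  witness (G ∷ G ∷ G ∷ A ∷ C ∷ G ∷ C ∷ A ∷ A ∷ A ∷ G ∷ C ∷ C ∷ A ∷ [])
          ((1 , 13) ∷ (2 , 12) ∷ (3 , 7) ∷ []) ((1 , 5) ∷ (6 , 12) ∷ (7 , 11) ∷ [])
          (triples (5 , 1 , 13) (11 , 7 , 3) (6 , 12 , 2))
representation₃ false true false =
  witness (G ∷ G ∷ G ∷ A ∷ A ∷ C ∷ C ∷ G ∷ A ∷ A ∷ G ∷ C ∷ C ∷ A ∷ [])
          ((2 , 13) ∷ (3 , 7) ∷ (8 , 12) ∷ []) ((1 , 12) ∷ (2 , 6) ∷ (7 , 11) ∷ [])
          (triples (6 , 2 , 13) (11 , 7 , 3) (1 , 12 , 8))
representation₃ false true true =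
  witness (G ∷ G ∷ A ∷ A ∷ A ∷ C ∷ C ∷ C ∷ C ∷ C ∷ A ∷ A ∷ A ∷ G ∷ [])
          ((1 , 9) ∷ (2 , 8) ∷ (10 , 14) ∷ []) ((1 , 7) ∷ (2 , 6) ∷ (8 , 14) ∷ [])
          (triples (7 , 1 , 9) (6 , 2 , 8) (8 , 14 , 10))
representation₃ true false false =
  witness (G ∷ G ∷ A ∷ A ∷ A ∷ C ∷ C ∷ C ∷ C ∷ C ∷ A ∷ A ∷ A ∷ G ∷ [])
          ((1 , 7) ∷ (2 , 6) ∷ (8 , 14) ∷ []) ((1 , 9) ∷ (2 , 8) ∷ (10 , 14) ∷ [])
          (triples (9 , 1 , 7) (8 , 2 , 6) (10 , 14 , 8))
representation₃ true false true =
  witness (G ∷ G ∷ G ∷ A ∷ A ∷ C ∷ C ∷ G ∷ A ∷ A ∷ G ∷ C ∷ C ∷ A ∷ [])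
          ((1 , 12) ∷ (2 , 6) ∷ (7 , 11) ∷ []) ((2 , 13) ∷ (3 , 7) ∷ (8 , 12) ∷ [])
          (triples (13 , 2 , 6) (3 , 7 , 11) (8 , 12 , 1))
representation₃ true true false =
  witness (G ∷ A ∷ A ∷ A ∷ C ∷ G ∷ C ∷ G ∷ C ∷ A ∷ A ∷ A ∷ G ∷ C ∷ [])
          ((1 , 7) ∷ (8 , 14) ∷ (9 , 13) ∷ []) ((1 , 5) ∷ (6 , 14) ∷ (7 , 13) ∷ [])
          (triples (5 , 1 , 7) (7 , 13 , 9) (6 , 14 , 8))
representation₃ true true true =
  witness (G ∷ A ∷ A ∷ A ∷ C ∷ G ∷ G ∷ A ∷ A ∷ A ∷ C ∷ C ∷ C ∷ C ∷ [])
          ((1 , 13) ∷ (6 , 12) ∷ (7 , 11) ∷ []) ((1 , 5) ∷ (6 , 14) ∷ (7 , 13) ∷ [])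
          (triples (5 , 1 , 13) (14 , 6 , 12) (13 , 7 , 11))

representation₃-certified : ∀ b₁₂ b₁₃ b₂₃ →
  True (certificate? (tournament₃ b₁₂ b₁₃ b₂₃) (representation₃ b₁₂ b₁₃ b₂₃))
representation₃-certified false false false = _
representation₃-certified false false true  = _
representation₃-certified false true  false = _
representation₃-certified false true  true  = _
representation₃-certified true  false false = _
representation₃-certified true  false true  = _
representation₃-certified true  true  false = _
representation₃-certified true  true  true  = _

proposition1 : (E : Digraph 3) → IsTournament E → Representable E
proposition1 E T = representable-resp (tournament₃-normal-form T) normal-form-representable
  where
  normal-form-representable : Representable (tournament₃ (E 𝟘 𝟙) (E 𝟘 𝟚) (E 𝟙 𝟚))
  normal-form-representable =
    certificate-sound (representation₃ (E 𝟘 𝟙) (E 𝟘 𝟚) (E 𝟙 𝟚))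
                      (toWitness (representation₃-certified (E 𝟘 𝟙) (E 𝟘 𝟚) (E 𝟙 𝟚)))
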